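{- Let $k\in\mathbb{Z}$ and $p\in\mathbb{N}$. Then $$\sum_{\nu=0}^{p}\binom{p}{\nu}\frac{E_{\nu}^{(k)}}{p-\nu+2}=\frac{1}{p+1}E_{p+1}^{(k)}(1)-\frac{1}{(p+1)(p+2)}E_{p+2}^{(k)}(1)+\frac{1}{(p+1)(p+2)}E_{p+2}^{(k)}.$$
   Context: For $k\in\mathbb{Z}$, $\mathrm{Ei}_k(x)=\sum_{n=1}^{\infty}\frac{x^n}{n^k (n-1)!}$; the poly-Genocchi polynomials $G_n^{(k)}(x)$ are defined by $\frac{2\,\mathrm{Ei}_k(\log(1+t))}{e^t+1}e^{xt}=\sum_{n=0}^{\infty}G_n^{(k)}(x)\frac{t^n}{n!}$; the poly-Euler polynomials are $E_n^{(k)}(x)=\frac{G_{n+1}^{(k)}(x)}{n+1}$ ($n\ge0$), and $E_n^{(k)}=E_n^{(k)}(0)$. -}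

module Defs where

open import Data.Nat as ℕ using (ℕ; zero; suc)
open import Data.Nat.Combinatorics using (_C_)
open import Data.Integer as ℤ using (ℤ; +_; -[1+_])
open import Data.Rational as ℚ using (ℚ; 0ℚ; 1ℚ; _+_; _*_; -_; _/_)
open import Data.List using (List; []; _∷_)

-- Formal power series over ℚ, as coefficient sequences: f n = [t^n] f.
Series : Set
Series = ℕ → ℚ

Σ≤ : ℕ → (ℕ → ℚ) → ℚ
Σ≤ zero    f = f 0
Σ≤ (suc n) f = Σ≤ n f + f (suc n)

ℕ→ℚ : ℕ → ℚ
ℕ→ℚ n = (+ n) / 1

_^ℚ_ : ℚ → ℕ → ℚ
q ^ℚ zero  = 1ℚ
q ^ℚ suc n = q * (q ^ℚ n)

invFact : ℕ → ℚ
invFact zero    = 1ℚ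
invFact (suc n) = invFact n * ((+ 1) / suc n)

factℚ : ℕ → ℚ
factℚ zero    = 1ℚ
factℚ (suc n) = ℕ→ℚ (suc n) * factℚ n

_⊛_ : Series → Series → Series
(f ⊛ g) n = Σ≤ n (λ i → f i * g (n ℕ.∸ i))

oneS : Series
oneS zero    = 1ℚ
oneS (suc _) = 0ℚ

powS : Series → ℕ → Series
powS f zero    = oneS
powS f (suc m) = f ⊛ powS f m

-- Multiplicative inverse of a series a with a 0 = 1:
-- b 0 = 1, b n = - Σ_{i=1}^{n} a i * b (n - i).
-- invPrefix a n = [b n, b (n-1), ..., b 0]
private
  weighted : Series → List ℚ → ℚ
  weighted a []       = 0ℚ
  weighted a (x ∷ xs) = a 1 * x + weighted (λ i → a (suc i)) xs

  invPrefix : Series → ℕ → List ℚ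
  invPrefix a zero    = 1ℚ ∷ []
  invPrefix a (suc n) = (- weighted a (invPrefix a n)) ∷ invPrefix a n

  headℚ : List ℚ → ℚ
  headℚ []      = 0ℚ
  headℚ (x ∷ _) = x

invS₁ : Series → Series
invS₁ a n = headℚ (invPrefix a n)

log1p : Series
log1p zero    = 0ℚ
log1p (suc n) = ((- 1ℚ) ^ℚ n) * ((+ 1) / suc n)

expS : ℚ → Series
expS x n = (x ^ℚ n) * invFact n

-- (e^t + 1)/2 , constant term 1
halfExpPlus1 : Series
halfExpPlus1 n = ((+ 1) / 2) * (expS 1ℚ n + oneS n)

twoOverExpPlus1 : Series
twoOverExpPlus1 = invS₁ halfExpPlus1

-- m^{-k} for m ≥ 1, k ∈ ℤ   (here m = suc m')
sucPowNeg : ℕ → ℤ → ℚ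
sucPowNeg m' (+ j)    = ((+ 1) / suc m') ^ℚ j
sucPowNeg m' -[1+ j ] = ℕ→ℚ (suc m') ^ℚ suc j

-- coefficients of Ei_k(y) = Σ_{m≥1} y^m / (m^k (m-1)!)
EiCoeff : ℤ → ℕ → ℚ
EiCoeff k zero     = 0ℚ
EiCoeff k (suc m') = sucPowNeg m' k * invFact m'

-- Ei_k(log(1+t)) as a series in t.  Since log(1+t) has no constant term,
-- (log(1+t))^m contributes only to t^n with n ≥ m, so the composition
-- coefficient is the finite sum over m ≤ n.
EiLog : ℤ → Series
EiLog k n = Σ≤ n (λ m → EiCoeff k m * powS log1p m n)

-- poly-Genocchi polynomials: G_n^{(k)}(x) = n! [t^n] 2 Ei_k(log(1+t))/(e^t+1) e^{xt}
polyGenocchi : ℤ → ℕ → ℚ → ℚ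
polyGenocchi k n x = factℚ n * ((EiLog k ⊛ twoOverExpPlus1) ⊛ expS x) n

-- poly-Euler polynomials: E_n^{(k)}(x) = G_{n+1}^{(k)}(x) / (n+1)
polyEuler : ℤ → ℕ → ℚ → ℚ
polyEuler k n x = polyGenocchi k (suc n) x * ((+ 1) / suc n)

polyEulerNum : ℤ → ℕ → ℚ
polyEulerNum k n = polyEuler k n 0ℚ

-- The poly-Euler polynomials form an Appell sequence: writing A for the
-- series Ei_k(log(1+t)) · 2/(e^t+1), which has no constant term, one has
-- E_n^{(k)}(x) = n! [t^n] (A(t)/t) e^{xt}, so E_n^{(k)}(1) = Σ_j C(n,j) E_j^{(k)}.
-- On the other hand, for j ≤ p,
--   C(p,j)/(p-j+2) = C(p+1,j)/(p+1) - C(p+2,j)/((p+1)(p+2)),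
-- because C(n+1,j)/(n+1) = C(n,j)/(n+1-j) and 1/(m+1) - 1/((m+1)(m+2)) = 1/(m+2).
-- Summing over j ≤ p and completing both binomial sums to the Appell sums for
-- E_{p+1}^{(k)}(1) and E_{p+2}^{(k)}(1), the two resulting multiples of E_{p+1}^{(k)}
-- cancel since (p+2) · 1/(p+2) = 1, and the multiple of E_{p+2}^{(k)} is
-- compensated by the last term.
module Submission where

open import Defs
open import Data.Nat as ℕ using (ℕ; zero; suc; _∸_; _≤_; _!; z≤n)
import Data.Nat.Properties as ℕ
open import Data.Nat.Combinatorics
  using (_C_; nCk≡n!/k![n-k]!; k![n∸k]!∣n!; nCn≡1; nC1≡n; nCk≡nC[n∸k])
open import Data.Nat.DivMod using (m/n*n≡m)
import Data.Nat.Coprimality as Coprime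
open import Data.Integer as ℤ using (ℤ; +_)
open import Data.Integer.Tactic.RingSolver using () renaming (ring to ℤ-ring)
open import Data.Rational using (ℚ; mkℚ; 0ℚ; 1ℚ; _+_; _-_; _*_; _/_; toℚᵘ)
open import Data.Rational.Properties
open import Data.Rational.Unnormalised using (*≡*)
import Data.Rational.Unnormalised.Properties as ℚᵘ
open import Relation.Nullary.Decidable using (dec⇒maybe)
open import Level using (0ℓ)
open import Function using (_∘_)
open import Relation.Binary.PropositionalEquality
open import Tactic.RingSolver using (solve-∀)
open import Tactic.RingSolver.Core.AlmostCommutativeRing
  using (AlmostCommutativeRing; fromCommutativeRing)
open ≡-Reasoning

-- Without the zero test the solver cannot discard vanishing coefficients.
ℚ-ring : AlmostCommutativeRing 0ℓ 0ℓ
ℚ-ring = fromCommutativeRing +-*-commutativeRing (λ q → dec⇒maybe (0ℚ ≟ q))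

1/[1+_] : ℕ → ℚ
1/[1+ n ] = (+ 1) / suc n

-- Already-reduced forms, which `↥p/↧p≡p` identifies with the normalising `_/_`.
private
  mkℚ-ℕ : ℕ → ℚ
  mkℚ-ℕ n = mkℚ (+ n) 0 (Coprime.sym (Coprime.1-coprimeTo n))

  mkℚ-1/[1+] : ℕ → ℚ
  mkℚ-1/[1+] n = mkℚ (+ 1) n (Coprime.1-coprimeTo (suc n))

  ℕ→ℚ≡mkℚ-ℕ : ∀ n → ℕ→ℚ n ≡ mkℚ-ℕ n
  ℕ→ℚ≡mkℚ-ℕ n = ↥p/↧p≡p (mkℚ-ℕ n)

  1/[1+]≡mkℚ-1/[1+] : ∀ n → 1/[1+ n ] ≡ mkℚ-1/[1+] n
  1/[1+]≡mkℚ-1/[1+] n = ↥p/↧p≡p (mkℚ-1/[1+] n)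

ℕ→ℚ-suc : ∀ n → ℕ→ℚ (suc n) ≡ 1ℚ + ℕ→ℚ n
ℕ→ℚ-suc n = begin
  ℕ→ℚ (suc n)     ≡⟨ ℕ→ℚ≡mkℚ-ℕ (suc n) ⟩
  mkℚ-ℕ (suc n)   ≡⟨ toℚᵘ-injective (ℚᵘ.≃-trans (*≡* (cross-multiplied (+ n)))
                                                 (ℚᵘ.≃-sym (toℚᵘ-homo-+ 1ℚ (mkℚ-ℕ n)))) ⟩
  1ℚ + mkℚ-ℕ n    ≡⟨ cong (λ q → 1ℚ + q) (ℕ→ℚ≡mkℚ-ℕ n) ⟨
  1ℚ + ℕ→ℚ n      ∎
  where
  cross-multiplied : ∀ i → (+ 1 ℤ.+ i) ℤ.* (+ 1 ℤ.* + 1) ≡ (+ 1 ℤ.* + 1 ℤ.+ i ℤ.* + 1) ℤ.* + 1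
  cross-multiplied = solve-∀ ℤ-ring

ℕ→ℚ-*-1/[1+] : ∀ n → ℕ→ℚ (suc n) * 1/[1+ n ] ≡ 1ℚ
ℕ→ℚ-*-1/[1+] n = begin
  ℕ→ℚ (suc n) * 1/[1+ n ]       ≡⟨ cong₂ _*_ (ℕ→ℚ≡mkℚ-ℕ (suc n)) (1/[1+]≡mkℚ-1/[1+] n) ⟩
  mkℚ-ℕ (suc n) * mkℚ-1/[1+] n  ≡⟨ toℚᵘ-injective (ℚᵘ.≃-trans (toℚᵘ-homo-* (mkℚ-ℕ (suc n)) (mkℚ-1/[1+] n))
                                                               (*≡* (cross-multiplied (+ suc n)))) ⟩
  1ℚ                            ∎
  where
  cross-multiplied : ∀ i → (i ℤ.* + 1) ℤ.* + 1 ≡ + 1 ℤ.* (+ 1 ℤ.* i)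
  cross-multiplied = solve-∀ ℤ-ring

ℕ→ℚ-+ : ∀ m n → ℕ→ℚ (m ℕ.+ n) ≡ ℕ→ℚ m + ℕ→ℚ n
ℕ→ℚ-+ zero    n = sym (+-identityˡ (ℕ→ℚ n))
ℕ→ℚ-+ (suc m) n = begin
  ℕ→ℚ (suc (m ℕ.+ n))         ≡⟨ ℕ→ℚ-suc (m ℕ.+ n) ⟩
  1ℚ + ℕ→ℚ (m ℕ.+ n)          ≡⟨ cong (λ q → 1ℚ + q) (ℕ→ℚ-+ m n) ⟩
  1ℚ + (ℕ→ℚ m + ℕ→ℚ n)        ≡⟨ +-assoc 1ℚ (ℕ→ℚ m) (ℕ→ℚ n) ⟨
  (1ℚ + ℕ→ℚ m) + ℕ→ℚ n        ≡⟨ cong (_+ ℕ→ℚ n) (ℕ→ℚ-suc m) ⟨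
  ℕ→ℚ (suc m) + ℕ→ℚ n         ∎

ℕ→ℚ-* : ∀ m n → ℕ→ℚ (m ℕ.* n) ≡ ℕ→ℚ m * ℕ→ℚ n
ℕ→ℚ-* zero    n = sym (*-zeroˡ (ℕ→ℚ n))
ℕ→ℚ-* (suc m) n = begin
  ℕ→ℚ (n ℕ.+ m ℕ.* n)         ≡⟨ ℕ→ℚ-+ n (m ℕ.* n) ⟩
  ℕ→ℚ n + ℕ→ℚ (m ℕ.* n)       ≡⟨ cong (λ q → ℕ→ℚ n + q) (ℕ→ℚ-* m n) ⟩
  ℕ→ℚ n + ℕ→ℚ m * ℕ→ℚ n       ≡⟨ distrib (ℕ→ℚ m) (ℕ→ℚ n) ⟩
  (1ℚ + ℕ→ℚ m) * ℕ→ℚ n        ≡⟨ cong (_* ℕ→ℚ n) (ℕ→ℚ-suc m) ⟨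
  ℕ→ℚ (suc m) * ℕ→ℚ n         ∎
  where
  distrib : ∀ x y → y + x * y ≡ (1ℚ + x) * y
  distrib = solve-∀ ℚ-ring

1/[1+]-partial-fraction : ∀ m → 1/[1+ m ] - 1/[1+ m ] * 1/[1+ suc m ] ≡ 1/[1+ suc m ]
1/[1+]-partial-fraction m = begin
  r - r * s                              ≡⟨ insert-unit r s ⟩
  r * 1ℚ - r * s                         ≡⟨ cong (λ a → r * a - r * s) m+2-cancels ⟨
  r * ((1ℚ + ℕ→ℚ (suc m)) * s) - r * s   ≡⟨ regroup r s (ℕ→ℚ (suc m)) ⟩
  (ℕ→ℚ (suc m) * r) * s                  ≡⟨ cong (_* s) (ℕ→ℚ-*-1/[1+] m) ⟩
  1ℚ * s                                 ≡⟨ *-identityˡ s ⟩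
  s                                      ∎
  where
  r = 1/[1+ m ]
  s = 1/[1+ suc m ]
  m+2-cancels : (1ℚ + ℕ→ℚ (suc m)) * s ≡ 1ℚ
  m+2-cancels = trans (cong (_* s) (sym (ℕ→ℚ-suc (suc m)))) (ℕ→ℚ-*-1/[1+] (suc m))
  insert-unit : ∀ x y → x - x * y ≡ x * 1ℚ - x * y
  insert-unit = solve-∀ ℚ-ring
  regroup : ∀ x y z → x * ((1ℚ + z) * y) - x * y ≡ (z * x) * y
  regroup = solve-∀ ℚ-ring

factℚ≡ℕ→ℚ-! : ∀ n → factℚ n ≡ ℕ→ℚ (n !)
factℚ≡ℕ→ℚ-! zero    = refl
factℚ≡ℕ→ℚ-! (suc n) = trans (cong (ℕ→ℚ (suc n) *_) (factℚ≡ℕ→ℚ-! n)) (sym (ℕ→ℚ-* (suc n) (n !)))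

factℚ-suc-*-1/[1+] : ∀ n → factℚ (suc n) * 1/[1+ n ] ≡ factℚ n
factℚ-suc-*-1/[1+] n = begin
  ℕ→ℚ (suc n) * factℚ n * 1/[1+ n ]    ≡⟨ swap (ℕ→ℚ (suc n)) (factℚ n) 1/[1+ n ] ⟩
  (ℕ→ℚ (suc n) * 1/[1+ n ]) * factℚ n  ≡⟨ cong (_* factℚ n) (ℕ→ℚ-*-1/[1+] n) ⟩
  1ℚ * factℚ n                         ≡⟨ *-identityˡ (factℚ n) ⟩
  factℚ n                              ∎
  where
  swap : ∀ x y z → x * y * z ≡ (x * z) * y
  swap = solve-∀ ℚ-ring

invFact-*-factℚ : ∀ n → invFact n * factℚ n ≡ 1ℚ
invFact-*-factℚ zero    = refl
invFact-*-factℚ (suc n) = begin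
  invFact n * 1/[1+ n ] * (ℕ→ℚ (suc n) * factℚ n)
    ≡⟨ regroup (invFact n) 1/[1+ n ] (ℕ→ℚ (suc n)) (factℚ n) ⟩
  (invFact n * factℚ n) * (ℕ→ℚ (suc n) * 1/[1+ n ])
    ≡⟨ cong₂ _*_ (invFact-*-factℚ n) (ℕ→ℚ-*-1/[1+] n) ⟩
  1ℚ ∎
  where
  regroup : ∀ a b c d → a * b * (c * d) ≡ (a * d) * (c * b)
  regroup = solve-∀ ℚ-ring

ℕ→ℚ-C-*-factℚ-*-factℚ : ∀ {n k} → k ≤ n → ℕ→ℚ (n C k) * factℚ k * factℚ (n ∸ k) ≡ factℚ n
ℕ→ℚ-C-*-factℚ-*-factℚ {n} {k} k≤n = begin
  ℕ→ℚ (n C k) * factℚ k * factℚ (n ∸ k)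
    ≡⟨ cong₂ (λ a b → ℕ→ℚ (n C k) * a * b) (factℚ≡ℕ→ℚ-! k) (factℚ≡ℕ→ℚ-! (n ∸ k)) ⟩
  ℕ→ℚ (n C k) * ℕ→ℚ (k !) * ℕ→ℚ ((n ∸ k) !)
    ≡⟨ trans (ℕ→ℚ-* ((n C k) ℕ.* k !) ((n ∸ k) !))
             (cong (_* ℕ→ℚ ((n ∸ k) !)) (ℕ→ℚ-* (n C k) (k !))) ⟨
  ℕ→ℚ ((n C k) ℕ.* k ! ℕ.* (n ∸ k) !)
    ≡⟨ cong ℕ→ℚ C-*-!-*-! ⟩
  ℕ→ℚ (n !)
    ≡⟨ factℚ≡ℕ→ℚ-! n ⟨
  factℚ n ∎
  where
  C-*-!-*-! : (n C k) ℕ.* k ! ℕ.* (n ∸ k) ! ≡ n !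
  C-*-!-*-! = begin
    (n C k) ℕ.* k ! ℕ.* (n ∸ k) !     ≡⟨ ℕ.*-assoc (n C k) (k !) ((n ∸ k) !) ⟩
    (n C k) ℕ.* (k ! ℕ.* (n ∸ k) !)   ≡⟨ cong (ℕ._* (k ! ℕ.* (n ∸ k) !)) (nCk≡n!/k![n-k]! k≤n) ⟩
    _                               ≡⟨ m/n*n≡m {{ℕ._!*_!≢0 k (n ∸ k)}} (k![n∸k]!∣n! k≤n) ⟩
    n !                             ∎

ℕ→ℚ-C≡factℚ-*-invFact-*-invFact : ∀ {n k} → k ≤ n →
  ℕ→ℚ (n C k) ≡ factℚ n * invFact k * invFact (n ∸ k)
ℕ→ℚ-C≡factℚ-*-invFact-*-invFact {n} {k} k≤n = begin
  ℕ→ℚ (n C k)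
    ≡⟨ trans (cong₂ (λ a b → ℕ→ℚ (n C k) * a * b) (invFact-*-factℚ k) (invFact-*-factℚ (n ∸ k)))
             (trans (*-identityʳ _) (*-identityʳ _)) ⟨
  ℕ→ℚ (n C k) * (invFact k * factℚ k) * (invFact (n ∸ k) * factℚ (n ∸ k))
    ≡⟨ regroup (ℕ→ℚ (n C k)) (factℚ k) (factℚ (n ∸ k)) (invFact k) (invFact (n ∸ k)) ⟩
  ℕ→ℚ (n C k) * factℚ k * factℚ (n ∸ k) * invFact k * invFact (n ∸ k)
    ≡⟨ cong (λ a → a * invFact k * invFact (n ∸ k)) (ℕ→ℚ-C-*-factℚ-*-factℚ k≤n) ⟩
  factℚ n * invFact k * invFact (n ∸ k) ∎
  where
  regroup : ∀ c a b a⁻¹ b⁻¹ → c * (a⁻¹ * a) * (b⁻¹ * b) ≡ c * a * b * a⁻¹ * b⁻¹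
  regroup = solve-∀ ℚ-ring

ℕ→ℚ-C-suc-*-1/[1+] : ∀ {n k} → k ≤ n → ℕ→ℚ (suc n C k) * 1/[1+ n ] ≡ ℕ→ℚ (n C k) * 1/[1+ n ∸ k ]
ℕ→ℚ-C-suc-*-1/[1+] {n} {k} k≤n = begin
  ℕ→ℚ (suc n C k) * 1/[1+ n ]
    ≡⟨ cong (_* 1/[1+ n ]) (ℕ→ℚ-C≡factℚ-*-invFact-*-invFact (ℕ.m≤n⇒m≤1+n k≤n)) ⟩
  factℚ (suc n) * invFact k * invFact (suc n ∸ k) * 1/[1+ n ]
    ≡⟨ cong (λ m → factℚ (suc n) * invFact k * invFact m * 1/[1+ n ]) (ℕ.+-∸-assoc 1 k≤n) ⟩
  factℚ (suc n) * invFact k * (invFact (n ∸ k) * 1/[1+ n ∸ k ]) * 1/[1+ n ]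
    ≡⟨ regroup (factℚ (suc n)) (invFact k) (invFact (n ∸ k)) 1/[1+ n ∸ k ] 1/[1+ n ] ⟩
  (factℚ (suc n) * 1/[1+ n ]) * invFact k * invFact (n ∸ k) * 1/[1+ n ∸ k ]
    ≡⟨ cong (λ a → a * invFact k * invFact (n ∸ k) * 1/[1+ n ∸ k ]) (factℚ-suc-*-1/[1+] n) ⟩
  factℚ n * invFact k * invFact (n ∸ k) * 1/[1+ n ∸ k ]
    ≡⟨ cong (_* 1/[1+ n ∸ k ]) (ℕ→ℚ-C≡factℚ-*-invFact-*-invFact k≤n) ⟨
  ℕ→ℚ (n C k) * 1/[1+ n ∸ k ] ∎
  where
  regroup : ∀ f a b c d → f * a * (b * c) * d ≡ (f * d) * a * b * c
  regroup = solve-∀ ℚ-ring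

ℕ→ℚ-C-*-1/[1+p∸k+1] : ∀ {p k} → k ≤ p →
  ℕ→ℚ (p C k) * 1/[1+ suc (p ∸ k) ]
    ≡ 1/[1+ p ] * ℕ→ℚ (suc p C k) - 1/[1+ p ] * 1/[1+ suc p ] * ℕ→ℚ (suc (suc p) C k)
ℕ→ℚ-C-*-1/[1+p∸k+1] {p} {k} k≤p = sym (begin
  u * ℕ→ℚ (suc p C k) - u * v * ℕ→ℚ (suc (suc p) C k)
    ≡⟨ regroup u v (ℕ→ℚ (suc p C k)) (ℕ→ℚ (suc (suc p) C k)) ⟩
  ℕ→ℚ (suc p C k) * u - ℕ→ℚ (suc (suc p) C k) * v * u
    ≡⟨ cong (λ a → ℕ→ℚ (suc p C k) * u - a * u) (ℕ→ℚ-C-suc-*-1/[1+] (ℕ.m≤n⇒m≤1+n k≤p)) ⟩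
  ℕ→ℚ (suc p C k) * u - ℕ→ℚ (suc p C k) * 1/[1+ suc p ∸ k ] * u
    ≡⟨ cong (λ m → ℕ→ℚ (suc p C k) * u - ℕ→ℚ (suc p C k) * 1/[1+ m ] * u) (ℕ.+-∸-assoc 1 k≤p) ⟩
  ℕ→ℚ (suc p C k) * u - ℕ→ℚ (suc p C k) * s * u
    ≡⟨ factor (ℕ→ℚ (suc p C k)) u s ⟩
  (ℕ→ℚ (suc p C k) * u) * (1ℚ - s)
    ≡⟨ cong (_* (1ℚ - s)) (ℕ→ℚ-C-suc-*-1/[1+] k≤p) ⟩
  ℕ→ℚ (p C k) * r * (1ℚ - s)
    ≡⟨ distrib (ℕ→ℚ (p C k)) r s ⟩
  ℕ→ℚ (p C k) * (r - r * s)
    ≡⟨ cong (ℕ→ℚ (p C k) *_) (1/[1+]-partial-fraction (p ∸ k)) ⟩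
  ℕ→ℚ (p C k) * s ∎)
  where
  u = 1/[1+ p ]
  v = 1/[1+ suc p ]
  r = 1/[1+ p ∸ k ]
  s = 1/[1+ suc (p ∸ k) ]
  regroup : ∀ u v a b → u * a - u * v * b ≡ a * u - b * v * u
  regroup = solve-∀ ℚ-ring
  factor : ∀ a u s → a * u - a * s * u ≡ (a * u) * (1ℚ - s)
  factor = solve-∀ ℚ-ring
  distrib : ∀ c r s → c * r * (1ℚ - s) ≡ c * (r - r * s)
  distrib = solve-∀ ℚ-ring

[1+n]Cn≡1+n : ∀ n → suc n C n ≡ suc n
[1+n]Cn≡1+n n = begin
  suc n C n             ≡⟨ nCk≡nC[n∸k] (ℕ.n≤1+n n) ⟩
  suc n C (suc n ∸ n)   ≡⟨ cong (suc n C_) (ℕ.m+n∸n≡m 1 n) ⟩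
  suc n C 1             ≡⟨ nC1≡n (suc n) ⟩
  suc n                 ∎

Σ≤-cong : ∀ n {f g : ℕ → ℚ} → (∀ i → i ≤ n → f i ≡ g i) → Σ≤ n f ≡ Σ≤ n g
Σ≤-cong zero    f≡g = f≡g 0 z≤n
Σ≤-cong (suc n) f≡g =
  cong₂ _+_ (Σ≤-cong n (λ i i≤n → f≡g i (ℕ.m≤n⇒m≤1+n i≤n))) (f≡g (suc n) ℕ.≤-refl)

Σ≤-zero : ∀ n → Σ≤ n (λ _ → 0ℚ) ≡ 0ℚ
Σ≤-zero zero    = refl
Σ≤-zero (suc n) = trans (+-identityʳ _) (Σ≤-zero n)

Σ≤-suc : ∀ n (f : ℕ → ℚ) → Σ≤ (suc n) f ≡ f 0 + Σ≤ n (f ∘ suc)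
Σ≤-suc zero    f = refl
Σ≤-suc (suc n) f = trans (cong (_+ f (suc (suc n))) (Σ≤-suc n f)) (+-assoc (f 0) _ _)

*-distribˡ-Σ≤ : ∀ n c (f : ℕ → ℚ) → c * Σ≤ n f ≡ Σ≤ n (λ i → c * f i)
*-distribˡ-Σ≤ zero    c f = refl
*-distribˡ-Σ≤ (suc n) c f =
  trans (*-distribˡ-+ c (Σ≤ n f) (f (suc n))) (cong (_+ c * f (suc n)) (*-distribˡ-Σ≤ n c f))

Σ≤-distrib-- : ∀ n (f g : ℕ → ℚ) → Σ≤ n (λ i → f i - g i) ≡ Σ≤ n f - Σ≤ n g
Σ≤-distrib-- zero    f g = refl
Σ≤-distrib-- (suc n) f g =
  trans (cong (_+ (f (suc n) - g (suc n))) (Σ≤-distrib-- n f g))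
        (interchange (Σ≤ n f) (Σ≤ n g) (f (suc n)) (g (suc n)))
  where
  interchange : ∀ a b c d → (a - b) + (c - d) ≡ (a + c) - (b + d)
  interchange = solve-∀ ℚ-ring

Σ≤-binomial-last : ∀ n (a : ℕ → ℚ) →
  Σ≤ (suc n) (λ j → ℕ→ℚ (suc n C j) * a j) ≡ Σ≤ n (λ j → ℕ→ℚ (suc n C j) * a j) + a (suc n)
Σ≤-binomial-last n a = cong (λ q → Σ≤ n (λ j → ℕ→ℚ (suc n C j) * a j) + q)
  (trans (cong (λ c → ℕ→ℚ c * a (suc n)) (nCn≡1 (suc n))) (*-identityˡ (a (suc n))))

Σ≤-C-*-1/[1+p∸j+1] : ∀ p (a : ℕ → ℚ) →
  Σ≤ p (λ j → ℕ→ℚ (p C j) * a j * 1/[1+ suc (p ∸ j) ])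
    ≡ 1/[1+ p ] * Σ≤ p (λ j → ℕ→ℚ (suc p C j) * a j)
      - 1/[1+ p ] * 1/[1+ suc p ] * Σ≤ p (λ j → ℕ→ℚ (suc (suc p) C j) * a j)
Σ≤-C-*-1/[1+p∸j+1] p a = begin
  Σ≤ p (λ j → ℕ→ℚ (p C j) * a j * 1/[1+ suc (p ∸ j) ])
    ≡⟨ Σ≤-cong p term ⟩
  Σ≤ p (λ j → u * (ℕ→ℚ (suc p C j) * a j) - u * v * (ℕ→ℚ (suc (suc p) C j) * a j))
    ≡⟨ Σ≤-distrib-- p _ _ ⟩
  Σ≤ p (λ j → u * (ℕ→ℚ (suc p C j) * a j)) - Σ≤ p (λ j → u * v * (ℕ→ℚ (suc (suc p) C j) * a j))
    ≡⟨ cong₂ _-_ (*-distribˡ-Σ≤ p u _) (*-distribˡ-Σ≤ p (u * v) _) ⟨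
  u * Σ≤ p (λ j → ℕ→ℚ (suc p C j) * a j) - u * v * Σ≤ p (λ j → ℕ→ℚ (suc (suc p) C j) * a j) ∎
  where
  u = 1/[1+ p ]
  v = 1/[1+ suc p ]
  term : ∀ j → j ≤ p → ℕ→ℚ (p C j) * a j * 1/[1+ suc (p ∸ j) ]
                       ≡ u * (ℕ→ℚ (suc p C j) * a j) - u * v * (ℕ→ℚ (suc (suc p) C j) * a j)
  term j j≤p = begin
    ℕ→ℚ (p C j) * a j * 1/[1+ suc (p ∸ j) ]
      ≡⟨ swap (ℕ→ℚ (p C j)) (a j) 1/[1+ suc (p ∸ j) ] ⟩
    ℕ→ℚ (p C j) * 1/[1+ suc (p ∸ j) ] * a j
      ≡⟨ cong (_* a j) (ℕ→ℚ-C-*-1/[1+p∸k+1] j≤p) ⟩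
    (u * ℕ→ℚ (suc p C j) - u * v * ℕ→ℚ (suc (suc p) C j)) * a j
      ≡⟨ distrib u (u * v) (ℕ→ℚ (suc p C j)) (ℕ→ℚ (suc (suc p) C j)) (a j) ⟩
    u * (ℕ→ℚ (suc p C j) * a j) - u * v * (ℕ→ℚ (suc (suc p) C j) * a j) ∎
    where
    swap : ∀ x y z → x * y * z ≡ x * z * y
    swap = solve-∀ ℚ-ring
    distrib : ∀ α β x y z → (α * x - β * y) * z ≡ α * (x * z) - β * (y * z)
    distrib = solve-∀ ℚ-ring

cancel-middle : ∀ {v w} → w * v ≡ 1ℚ → ∀ u S₁ S₂ x y →
  u * (S₁ + x) - u * v * ((S₂ + w * x) + y) + u * v * y ≡ u * S₁ - u * v * S₂
cancel-middle {v} {w} w*v≡1 u S₁ S₂ x y = begin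
  u * (S₁ + x) - u * v * ((S₂ + w * x) + y) + u * v * y  ≡⟨ expand u v w S₁ S₂ x y ⟩
  u * S₁ - u * v * S₂ + u * x * (1ℚ - w * v)             ≡⟨ cong (λ c → u * S₁ - u * v * S₂ + u * x * (1ℚ - c)) w*v≡1 ⟩
  u * S₁ - u * v * S₂ + u * x * (1ℚ - 1ℚ)                ≡⟨ vanish u v S₁ S₂ x ⟩
  u * S₁ - u * v * S₂                                    ∎
  where
  expand : ∀ u v w S₁ S₂ x y → u * (S₁ + x) - u * v * ((S₂ + w * x) + y) + u * v * y
                              ≡ u * S₁ - u * v * S₂ + u * x * (1ℚ - w * v)
  expand = solve-∀ ℚ-ring
  vanish : ∀ u v S₁ S₂ x → u * S₁ - u * v * S₂ + u * x * (1ℚ - 1ℚ) ≡ u * S₁ - u * v * S₂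
  vanish = solve-∀ ℚ-ring

⊛-congʳ : ∀ (f : Series) {g h : Series} → (∀ n → g n ≡ h n) → ∀ n → (f ⊛ g) n ≡ (f ⊛ h) n
⊛-congʳ f g≡h n = Σ≤-cong n (λ i _ → cong (f i *_) (g≡h (n ∸ i)))

⊛-identityʳ : ∀ (f : Series) n → (f ⊛ oneS) n ≡ f n
⊛-identityʳ f zero    = *-identityʳ (f 0)
⊛-identityʳ f (suc n) = begin
  Σ≤ n (λ i → f i * oneS (suc n ∸ i)) + f (suc n) * oneS (n ∸ n)
    ≡⟨ cong₂ _+_ (trans (Σ≤-cong n off-diagonal) (Σ≤-zero n))
                 (trans (cong (λ m → f (suc n) * oneS m) (ℕ.n∸n≡0 n)) (*-identityʳ (f (suc n)))) ⟩
  0ℚ + f (suc n)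
    ≡⟨ +-identityˡ (f (suc n)) ⟩
  f (suc n) ∎
  where
  off-diagonal : ∀ i → i ≤ n → f i * oneS (suc n ∸ i) ≡ 0ℚ
  off-diagonal i i≤n = trans (cong (λ m → f i * oneS m) (ℕ.+-∸-assoc 1 i≤n)) (*-zeroʳ (f i))

⊛-suc : ∀ (f g : Series) n → (f ⊛ g) (suc n) ≡ f 0 * g (suc n) + ((f ∘ suc) ⊛ g) n
⊛-suc f g n = Σ≤-suc n (λ i → f i * g (suc n ∸ i))

expS-0 : ∀ n → expS 0ℚ n ≡ oneS n
expS-0 zero    = refl
expS-0 (suc n) = trans (cong (_* invFact (suc n)) (*-zeroˡ (0ℚ ^ℚ n))) (*-zeroˡ (invFact (suc n)))

1^ℚ : ∀ n → 1ℚ ^ℚ n ≡ 1ℚ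
1^ℚ zero    = refl
1^ℚ (suc n) = trans (*-identityˡ (1ℚ ^ℚ n)) (1^ℚ n)

expS-1 : ∀ n → expS 1ℚ n ≡ invFact n
expS-1 n = trans (cong (_* invFact n) (1^ℚ n)) (*-identityˡ (invFact n))

factℚ-*-⊛-expS-1 : ∀ (f : Series) n →
  factℚ n * (f ⊛ expS 1ℚ) n ≡ Σ≤ n (λ j → ℕ→ℚ (n C j) * (factℚ j * f j))
factℚ-*-⊛-expS-1 f n = begin
  factℚ n * (f ⊛ expS 1ℚ) n                          ≡⟨ cong (factℚ n *_) (⊛-congʳ f expS-1 n) ⟩
  factℚ n * Σ≤ n (λ j → f j * invFact (n ∸ j))       ≡⟨ *-distribˡ-Σ≤ n (factℚ n) _ ⟩
  Σ≤ n (λ j → factℚ n * (f j * invFact (n ∸ j)))     ≡⟨ Σ≤-cong n term ⟩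
  Σ≤ n (λ j → ℕ→ℚ (n C j) * (factℚ j * f j))         ∎
  where
  term : ∀ j → j ≤ n → factℚ n * (f j * invFact (n ∸ j)) ≡ ℕ→ℚ (n C j) * (factℚ j * f j)
  term j j≤n = begin
    factℚ n * (f j * invFact (n ∸ j))
      ≡⟨ cong (_* (f j * invFact (n ∸ j))) (ℕ→ℚ-C-*-factℚ-*-factℚ j≤n) ⟨
    ℕ→ℚ (n C j) * factℚ j * factℚ (n ∸ j) * (f j * invFact (n ∸ j))
      ≡⟨ regroup (ℕ→ℚ (n C j)) (factℚ j) (factℚ (n ∸ j)) (f j) (invFact (n ∸ j)) ⟩
    ℕ→ℚ (n C j) * (factℚ j * f j) * (invFact (n ∸ j) * factℚ (n ∸ j))
      ≡⟨ cong (ℕ→ℚ (n C j) * (factℚ j * f j) *_) (invFact-*-factℚ (n ∸ j)) ⟩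
    ℕ→ℚ (n C j) * (factℚ j * f j) * 1ℚ
      ≡⟨ *-identityʳ _ ⟩
    ℕ→ℚ (n C j) * (factℚ j * f j) ∎
    where
    regroup : ∀ c a b x y → c * a * b * (x * y) ≡ c * (a * x) * (y * b)
    regroup = solve-∀ ℚ-ring

module _ (k : ℤ) where

  polyGenocchiGF : Series
  polyGenocchiGF = EiLog k ⊛ twoOverExpPlus1

  polyGenocchiGF-0 : polyGenocchiGF 0 ≡ 0ℚ
  polyGenocchiGF-0 = trans (cong (_* twoOverExpPlus1 0) (*-zeroˡ (powS log1p 0 0)))
                           (*-zeroˡ (twoOverExpPlus1 0))

  polyEuler≡factℚ-*-⊛ : ∀ n x → polyEuler k n x ≡ factℚ n * ((polyGenocchiGF ∘ suc) ⊛ expS x) n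
  polyEuler≡factℚ-*-⊛ n x = begin
    factℚ (suc n) * (G ⊛ expS x) (suc n) * 1/[1+ n ]
      ≡⟨ swap (factℚ (suc n)) ((G ⊛ expS x) (suc n)) 1/[1+ n ] ⟩
    factℚ (suc n) * 1/[1+ n ] * (G ⊛ expS x) (suc n)
      ≡⟨ cong₂ _*_ (factℚ-suc-*-1/[1+] n) (⊛-suc G (expS x) n) ⟩
    factℚ n * (G 0 * expS x (suc n) + ((G ∘ suc) ⊛ expS x) n)
      ≡⟨ cong (λ c → factℚ n * (c * expS x (suc n) + ((G ∘ suc) ⊛ expS x) n)) polyGenocchiGF-0 ⟩
    factℚ n * (0ℚ * expS x (suc n) + ((G ∘ suc) ⊛ expS x) n)
      ≡⟨ cong (factℚ n *_) (trans (cong (_+ ((G ∘ suc) ⊛ expS x) n) (*-zeroˡ (expS x (suc n))))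
                                   (+-identityˡ (((G ∘ suc) ⊛ expS x) n))) ⟩
    factℚ n * ((G ∘ suc) ⊛ expS x) n ∎
    where
    G = polyGenocchiGF
    swap : ∀ a b c → a * b * c ≡ a * c * b
    swap = solve-∀ ℚ-ring

  polyEulerNum≡factℚ-* : ∀ n → polyEulerNum k n ≡ factℚ n * polyGenocchiGF (suc n)
  polyEulerNum≡factℚ-* n = trans (polyEuler≡factℚ-*-⊛ n 0ℚ) (cong (factℚ n *_)
    (trans (⊛-congʳ (polyGenocchiGF ∘ suc) expS-0 n) (⊛-identityʳ (polyGenocchiGF ∘ suc) n)))

  polyEuler-1 : ∀ n → polyEuler k n 1ℚ ≡ Σ≤ n (λ j → ℕ→ℚ (n C j) * polyEulerNum k j)
  polyEuler-1 n = begin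
    polyEuler k n 1ℚ
      ≡⟨ polyEuler≡factℚ-*-⊛ n 1ℚ ⟩
    factℚ n * ((polyGenocchiGF ∘ suc) ⊛ expS 1ℚ) n
      ≡⟨ factℚ-*-⊛-expS-1 (polyGenocchiGF ∘ suc) n ⟩
    Σ≤ n (λ j → ℕ→ℚ (n C j) * (factℚ j * polyGenocchiGF (suc j)))
      ≡⟨ Σ≤-cong n (λ j _ → cong (ℕ→ℚ (n C j) *_) (polyEulerNum≡factℚ-* j)) ⟨
    Σ≤ n (λ j → ℕ→ℚ (n C j) * polyEulerNum k j) ∎

lemma9 : (k : ℤ) (p : ℕ) →
    Σ≤ p (λ ν → ℕ→ℚ (p C ν) * polyEulerNum k ν * ((+ 1) / suc (suc (p ∸ ν))))
      ≡ ((+ 1) / suc p) * polyEuler k (suc p) 1ℚ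
        - ((+ 1) / suc p) * ((+ 1) / suc (suc p)) * polyEuler k (suc (suc p)) 1ℚ
        + ((+ 1) / suc p) * ((+ 1) / suc (suc p)) * polyEulerNum k (suc (suc p))
lemma9 k p = begin
  Σ≤ p (λ ν → ℕ→ℚ (p C ν) * a ν * 1/[1+ suc (p ∸ ν) ])
    ≡⟨ Σ≤-C-*-1/[1+p∸j+1] p a ⟩
  u * S₁ - u * v * S₂
    ≡⟨ cancel-middle {w = ℕ→ℚ (suc (suc p))} (ℕ→ℚ-*-1/[1+] (suc p)) u S₁ S₂ (a (suc p)) (a (suc (suc p))) ⟨
  u * (S₁ + a (suc p)) - u * v * ((S₂ + ℕ→ℚ (suc (suc p)) * a (suc p)) + a (suc (suc p)))
    + u * v * a (suc (suc p))
    ≡⟨ cong₂ (λ e₁ e₂ → u * e₁ - u * v * e₂ + u * v * a (suc (suc p))) E₁ E₂ ⟨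
  u * polyEuler k (suc p) 1ℚ - u * v * polyEuler k (suc (suc p)) 1ℚ + u * v * a (suc (suc p)) ∎
  where
  a = polyEulerNum k
  u = 1/[1+ p ]
  v = 1/[1+ suc p ]
  S₁ = Σ≤ p (λ j → ℕ→ℚ (suc p C j) * a j)
  S₂ = Σ≤ p (λ j → ℕ→ℚ (suc (suc p) C j) * a j)
  E₁ : polyEuler k (suc p) 1ℚ ≡ S₁ + a (suc p)
  E₁ = trans (polyEuler-1 k (suc p)) (Σ≤-binomial-last p a)
  E₂ : polyEuler k (suc (suc p)) 1ℚ ≡ (S₂ + ℕ→ℚ (suc (suc p)) * a (suc p)) + a (suc (suc p))
  E₂ = trans (polyEuler-1 k (suc (suc p))) (trans (Σ≤-binomial-last (suc p) a)
         (cong (λ c → S₂ + ℕ→ℚ c * a (suc p) + a (suc (suc p))) ([1+n]Cn≡1+n (suc p))))
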